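{- Suppose $s \geq 2$ and $G=K_{1,s}$ with bipartition $\{z\}$, $\{x_1, \ldots, x_s\}$. Suppose $L$ is an $(s+1)$-assignment for $G$ such that $L(x_1), \ldots , L(x_s)$ are pairwise disjoint. Then $$\big|\{f(V(G)): f \text{ is a proper } L\text{ -coloring of } G\}\big| \geq \binom{s+1}{2}(s+1)^{s-1}.$$
   Context: $K_{1,s}$ is the star with center $z$ and leaves $x_1,\dots,x_s$. A list assignment $L$ for $G$ assigns to each vertex $v$ a set $L(v)$ of colors; it is a $k$-assignment if $|L(v)|=k$ for all $v$. A proper $L$-coloring is a proper coloring $f$ of $G$ with $f(v)\in L(v)$ for every vertex $v$. For a function $f$, $f(V(G))=\{f(v): v\in V(G)\}$; the left-hand side counts the distinct sets of colors used by proper $L$-colorings. -}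

module Defs where

open import Data.Nat using (ℕ; suc)
open import Data.Fin using (Fin)
open import Data.List using (List; length)
open import Data.List.Membership.Propositional using (_∈_; _∉_)
open import Data.List.Relation.Unary.Unique.Propositional using (Unique)
open import Data.Product using (_×_; ∃)
open import Relation.Binary.PropositionalEquality using (_≡_; _≢_)
open import Function.Bundles using (_⇔_)

data StarV (s : ℕ) : Set where
  centre : StarV s
  leaf   : Fin s → StarV s

data Adj {s : ℕ} : StarV s → StarV s → Set where
  z-x : (i : Fin s) → Adj centre (leaf i)
  x-z : (i : Fin s) → Adj (leaf i) centre

-- Colours are natural numbers; a list assignment gives each vertex a finite
-- set of colours, represented as a duplicate-free list.
ListAssignment : ℕ → Set
ListAssignment s = StarV s → List ℕ

IsKAssignment : {s : ℕ} → ℕ → ListAssignment s → Set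
IsKAssignment k L = ∀ v → Unique (L v) × length (L v) ≡ k

IsProper : {s : ℕ} → (StarV s → ℕ) → Set
IsProper f = ∀ u v → Adj u v → f u ≢ f v

IsProperLColoring : {s : ℕ} → ListAssignment s → (StarV s → ℕ) → Set
IsProperLColoring L f = IsProper f × (∀ v → f v ∈ L v)

_∈Img_ : {s : ℕ} → ℕ → (StarV s → ℕ) → Set
c ∈Img f = ∃ λ v → f v ≡ c

SameImage : {s : ℕ} → (StarV s → ℕ) → (StarV s → ℕ) → Set
SameImage f g = ∀ c → (c ∈Img f) ⇔ (c ∈Img g)

LeavesDisjoint : {s : ℕ} → ListAssignment s → Set
LeavesDisjoint {s} L = ∀ (i j : Fin s) → i ≢ j → ∀ c → c ∈ L (leaf i) → c ∉ L (leaf j)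

{-# OPTIONS --safe #-}
-- Enumerate L(z) as c₀, …, cₛ. The k-th block consists of the colourings that give z
-- the colour cₖ and each leaf xᵢ any colour of L(xᵢ) other than cₖ, except that the
-- (unique, by disjointness) leaf xⱼ with cₖ ∈ L(xⱼ) must also avoid c₀, …, cₖ₋₁.
-- That leaf keeps at least s − k colours and every other leaf all s + 1, so the block
-- has at least (s − k)(s + 1)^(s − 1) members; summing over k gives C(s+1,2)(s+1)^(s−1).
-- Within a block the colour set determines every leaf colour, because the leaf lists
-- are disjoint and avoid the centre colour. Two colourings from blocks k < k' have
-- different colour sets: cₖ' occurs in the earlier one at the leaf xⱼ owning cₖ', and
-- the later one colours xⱼ with neither cₖ' nor cₖ.
module Submission where

open import Defs
open import Data.Nat using (ℕ; zero; suc; _+_; _*_; _^_; _∸_; _≤_; z≤n; s≤s; s≤s⁻¹; _≟_)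
open import Data.Nat.Properties
open import Data.Nat.Combinatorics using (_C_; nC1≡n; nCk+nC[k+1]≡[n+1]C[k+1])
open import Data.Fin using (Fin; zero; suc; punchIn)
open import Data.Fin.Properties using (punchInᵢ≢i; any?) renaming (_≟_ to _≟ᶠ_)
open import Data.Vec.Functional using (head; tail; removeAt)
import Data.Vec.Functional as Vector
open import Data.List using (List; []; _∷_; [_]; length; map; _++_; filter; cartesianProductWith)
open import Data.List.Properties using (length-++; length-map; filter-all; filter-accept; filter-reject)
open import Data.List.Relation.Unary.All as All using (All; []; _∷_)
import Data.List.Relation.Unary.All.Properties as Allₚ
open import Data.List.Relation.Unary.AllPairs using (AllPairs; []; _∷_)
import Data.List.Relation.Unary.AllPairs.Properties as AllPairsₚ
open import Data.List.Relation.Unary.Any using (here; there)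
open import Data.List.Relation.Unary.Unique.Propositional using (Unique)
import Data.List.Relation.Unary.Unique.Propositional.Properties as Uniqueₚ
import Data.List.Relation.Unary.Unique.Setoid as Setoid
import Data.List.Relation.Unary.Unique.Setoid.Properties as Setoidₚ
open import Data.List.Relation.Binary.Subset.Propositional using (_⊆_)
open import Data.List.Relation.Binary.Subset.Propositional.Properties using (⊆-refl)
open import Data.List.Membership.Propositional using (_∈_; _∉_)
open import Data.List.Membership.Propositional.Properties using (∈-filter⁻; ∈-cartesianProductWith⁻)
open import Data.List.Membership.DecPropositional _≟_ using (_∈?_)
open import Data.Product using (_×_; ∃; ∃₂; _,_; proj₁; proj₂)
open import Data.Empty using (⊥-elim)
open import Relation.Nullary using (¬_; Dec; yes; no; ¬?)
open import Relation.Binary.PropositionalEquality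
  using (_≡_; _≢_; refl; sym; trans; cong; cong₂; subst; ≢-sym; setoid; _→-setoid_; module ≡-Reasoning)
open import Function using (_∘_)
open import Function.Bundles using (Equivalence)
open import Algebra.Properties.CommutativeMonoid.Sum *-1-commutativeMonoid
  using () renaming (sum to product; sum-remove to product-removeAt; sum-cong-≗ to product-cong)

_∖_ : List ℕ → List ℕ → List ℕ
X ∖ []      = X
X ∖ (q ∷ Q) = filter (¬? ∘ (_≟ q)) X ∖ Q

∈-∖⁻ : ∀ {x} X Q → x ∈ X ∖ Q → x ∈ X × x ∉ Q
∈-∖⁻ X []      x∈ = x∈ , λ ()
∈-∖⁻ X (q ∷ Q) x∈ with ∈-∖⁻ _ Q x∈
... | x∈X≢q , x∉Q with ∈-filter⁻ (¬? ∘ (_≟ q)) {xs = X} x∈X≢q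
...   | x∈X , x≢q = x∈X , λ { (here x≡q) → x≢q x≡q ; (there x∈Q) → x∉Q x∈Q }

∖-unique : ∀ {X} Q → Unique X → Unique (X ∖ Q)
∖-unique []      X! = X!
∖-unique (q ∷ Q) X! = ∖-unique Q (Uniqueₚ.filter⁺ (¬? ∘ (_≟ q)) X!)

length-filter-≢ : ∀ q {X} → Unique X → length X ≤ suc (length (filter (¬? ∘ (_≟ q)) X))
length-filter-≢ q {[]}    []          = z≤n
length-filter-≢ q {x ∷ X} (x∉X ∷ X!) with x ≟ q
... | no  x≢q = begin
  suc (length X)                             ≤⟨ s≤s (length-filter-≢ q X!) ⟩
  suc (suc (length (filter ≢q? X)))         ≡⟨ cong (suc ∘ length) (filter-accept ≢q? x≢q) ⟨
  suc (length (filter ≢q? (x ∷ X)))         ∎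
  where open ≤-Reasoning
        ≢q? = ¬? ∘ (_≟ q)
... | yes refl = begin
  suc (length X)                             ≡⟨ cong (suc ∘ length) (filter-all ≢x? (All.map ≢-sym x∉X)) ⟨
  suc (length (filter ≢x? X))               ≡⟨ cong (suc ∘ length) (filter-reject ≢x? (λ x≢x → x≢x refl)) ⟨
  suc (length (filter ≢x? (x ∷ X)))         ∎
  where open ≤-Reasoning
        ≢x? = ¬? ∘ (_≟ x)

length-∖ : ∀ {X} Q → Unique X → length X ≤ length Q + length (X ∖ Q)
length-∖ []      X! = ≤-refl
length-∖ (q ∷ Q) X! =
  ≤-trans (length-filter-≢ q X!) (s≤s (length-∖ Q (Uniqueₚ.filter⁺ (¬? ∘ (_≟ q)) X!)))

length-cartesianProductWith : ∀ {A B C : Set} (f : A → B → C) xs ys →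
  length (cartesianProductWith f xs ys) ≡ length xs * length ys
length-cartesianProductWith f []       ys = refl
length-cartesianProductWith f (x ∷ xs) ys = begin
  length (map (f x) ys ++ cartesianProductWith f xs ys)
    ≡⟨ length-++ (map (f x) ys) ⟩
  length (map (f x) ys) + length (cartesianProductWith f xs ys)
    ≡⟨ cong₂ _+_ (length-map (f x) ys) (length-cartesianProductWith f xs ys) ⟩
  length ys + length xs * length ys ∎
  where open ≡-Reasoning

tuples : ∀ {A : Set} {k} → (Fin k → List A) → List (Fin k → A)
tuples {k = zero}  ls = [ Vector.[] ]
tuples {k = suc k} ls = cartesianProductWith Vector._∷_ (head ls) (tuples (tail ls))

length-tuples : ∀ {A : Set} {k} (ls : Fin k → List A) → length (tuples ls) ≡ product (length ∘ ls)
length-tuples {k = zero}  ls = refl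
length-tuples {k = suc k} ls =
  trans (length-cartesianProductWith Vector._∷_ (head ls) (tuples (tail ls)))
        (cong (length (head ls) *_) (length-tuples (tail ls)))

∈-tuples⁻ : ∀ {A : Set} {k} {ls : Fin k → List A} {g} → g ∈ tuples ls → ∀ i → g i ∈ ls i
∈-tuples⁻ {k = suc k} {ls} g∈ i
  with _ , _ , a∈ , t∈ , refl ← ∈-cartesianProductWith⁻ Vector._∷_ (head ls) (tuples (tail ls)) g∈
  with i
... | zero  = a∈
... | suc i = ∈-tuples⁻ t∈ i

-- Distinctness is pointwise: without function extensionality, tuples that agree
-- at every index cannot be identified.
tuples-unique : ∀ {A : Set} {k} {ls : Fin k → List A} →
  (∀ i → Unique (ls i)) → Setoid.Unique (Fin k →-setoid A) (tuples ls)
tuples-unique {k = zero}          ls! = [] ∷ []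
tuples-unique {A} {k = suc k} ls! =
  Setoidₚ.cartesianProductWith⁺ (setoid A) (Fin k →-setoid A) (Fin (suc k) →-setoid A)
    Vector._∷_ (λ eq → eq zero , eq ∘ suc) (ls! zero) (tuples-unique (ls! ∘ suc))

product-const : ∀ k n → product {k} (λ _ → n) ≡ n ^ k
product-const zero    n = refl
product-const (suc k) n = cong (n *_) (product-const k n)

product-constExcept : ∀ {k n} (f : Fin (suc k) → ℕ) j → (∀ i → i ≢ j → f i ≡ n) →
  product f ≡ f j * n ^ k
product-constExcept {k} {n} f j f≡n = begin
  product f                     ≡⟨ product-removeAt {i = j} f ⟩
  f j * product (removeAt f j)  ≡⟨ cong (f j *_) (product-cong (λ i → f≡n (punchIn j i) (punchInᵢ≢i j i))) ⟩
  f j * product {k} (λ _ → n)   ≡⟨ cong (f j *_) (product-const k n) ⟩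
  f j * n ^ k                   ∎
  where open ≡-Reasoning

[1+m]C2≡m+mC2 : ∀ m → suc m C 2 ≡ m + m C 2
[1+m]C2≡m+mC2 m = trans (sym (nCk+nC[k+1]≡[n+1]C[k+1] m 1)) (cong (_+ m C 2) (nC1≡n m))

available : (c : ℕ) → List ℕ → (X : List ℕ) → Dec (c ∈ X) → List ℕ
available c P X (yes _) = X ∖ (c ∷ P)
available c P X (no  _) = X

module _ {c : ℕ} {P X : List ℕ} where

  available⊆ : ∀ d → available c P X d ⊆ X
  available⊆ (yes _) x∈ = proj₁ (∈-∖⁻ X (c ∷ P) x∈)
  available⊆ (no  _) x∈ = x∈

  available-≢ : ∀ d {x} → x ∈ available c P X d → x ≢ c
  available-≢ (yes _) x∈ x≡c = proj₂ (∈-∖⁻ X (c ∷ P) x∈) (here x≡c)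
  available-≢ (no c∉X) x∈ refl = c∉X x∈

  available-∉ : ∀ d {x} → c ∈ X → x ∈ available c P X d → x ∉ P
  available-∉ (yes _)  c∈X x∈ x∈P = proj₂ (∈-∖⁻ X (c ∷ P) x∈) (there x∈P)
  available-∉ (no c∉X) c∈X x∈ = ⊥-elim (c∉X c∈X)

  available-of-∉ : c ∉ X → ∀ d → available c P X d ≡ X
  available-of-∉ c∉X (yes c∈X) = ⊥-elim (c∉X c∈X)
  available-of-∉ c∉X (no  _)   = refl

  available-unique : ∀ d → Unique X → Unique (available c P X d)
  available-unique (yes _) X! = ∖-unique (c ∷ P) X!
  available-unique (no  _) X! = X!

  length-available : ∀ d → Unique X → length X ≤ suc (length P) + length (available c P X d)
  length-available (yes _) X! = length-∖ (c ∷ P) X!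
  length-available (no  _) X! = m≤n+m (length X) (suc (length P))

module Construction {s-1 : ℕ} (L : ListAssignment (suc s-1))
                    (L-size : IsKAssignment (suc (suc s-1)) L) (disjoint : LeavesDisjoint L) where

  s n : ℕ
  s = suc s-1
  n = suc s

  Colouring : Set
  Colouring = StarV s → ℕ

  X : Fin s → List ℕ
  X i = L (leaf i)

  A : ℕ → List ℕ → Fin s → List ℕ
  A c P i = available c P (X i) (c ∈? X i)

  A⊆X : ∀ {c P} i → A c P i ⊆ X i
  A⊆X {c} i = available⊆ (c ∈? X i)

  A-≢ : ∀ {c P} i {x} → x ∈ A c P i → x ≢ c
  A-≢ {c} i = available-≢ (c ∈? X i)

  A-∉ : ∀ {c P} i {x} → c ∈ X i → x ∈ A c P i → x ∉ P
  A-∉ {c} i = available-∉ (c ∈? X i)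

  sameLeaf : ∀ i k {x} → x ∈ X i → x ∈ X k → i ≡ k
  sameLeaf i k x∈Xi x∈Xk with i ≟ᶠ k
  ... | yes i≡k = i≡k
  ... | no  i≢k = ⊥-elim (disjoint i k i≢k _ x∈Xi x∈Xk)

  owner : ∀ c → ∃ λ j → ∀ i → i ≢ j → c ∉ X i
  owner c with any? (λ i → c ∈? X i)
  ... | yes (j , c∈Xj) = j , λ i i≢j c∈Xi → i≢j (sameLeaf i j c∈Xi c∈Xj)
  ... | no  c∉any      = zero , λ i _ c∈Xi → c∉any (i , c∈Xi)

  record Fits (c : ℕ) (P : List ℕ) (f : Colouring) : Set where
    constructor _,_
    field
      centre-colour : f centre ≡ c
      leaf-colour   : ∀ i → f (leaf i) ∈ A c P i

  fits-proper : ∀ {c P f} → c ∈ L centre → Fits c P f → IsProperLColoring L f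
  fits-proper {f = f} c∈Z (fz , fx) = proper , inList
    where
      proper : IsProper f
      proper _ _ (z-x i) fz≡fi = A-≢ i (fx i) (trans (sym fz≡fi) fz)
      proper _ _ (x-z i) fi≡fz = A-≢ i (fx i) (trans fi≡fz fz)
      inList : ∀ v → f v ∈ L v
      inList centre   = subst (_∈ L centre) (sym fz) c∈Z
      inList (leaf i) = A⊆X i (fx i)

  fits-sameImage⇒leaves≡ : ∀ {c P f f'} → Fits c P f → Fits c P f' → SameImage f f' →
    ∀ i → f (leaf i) ≡ f' (leaf i)
  fits-sameImage⇒leaves≡ {f = f} (fz , fx) (f'z , f'x) same i
    with Equivalence.to (same (f (leaf i))) (leaf i , refl)
  ... | centre , f'z≡fi = ⊥-elim (A-≢ i (fx i) (trans (sym f'z≡fi) f'z))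
  ... | leaf k , f'k≡fi
    with refl ← sameLeaf k i (A⊆X k (f'x k)) (subst (_∈ X i) (sym f'k≡fi) (A⊆X i (fx i)))
    = sym f'k≡fi

  fits-separated : ∀ {c P f c' P' f'} → Fits c P f → Fits c' P' f' → c ∈ P' → c' ≢ c →
    ¬ SameImage f f'
  fits-separated {f = f} {c' = c'} {P' = P'} {f' = f'} (fz , fx) (f'z , f'x) c∈P' c'≢c same
    with Equivalence.from (same _) (centre , f'z)
  ... | centre , fz≡c' = c'≢c (trans (sym fz≡c') fz)
  ... | leaf k , fk≡c'
    with Equivalence.from (same (f' (leaf k))) (leaf k , refl)
  ... | centre , fz≡f'k = A-∉ k c'∈Xk (f'x k) (subst (_∈ P') (trans (sym fz) fz≡f'k) c∈P')
    where
      c'∈Xk : c' ∈ X k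
      c'∈Xk = subst (_∈ X k) fk≡c' (A⊆X k (fx k))
  ... | leaf l , fl≡f'k
    with refl ← sameLeaf l k (A⊆X l (fx l)) (subst (_∈ X k) (sym fl≡f'k) (A⊆X k (f'x k)))
    = A-≢ k (f'x k) (trans (sym fl≡f'k) fk≡c')

  star : ℕ → (Fin s → ℕ) → Colouring
  star c g centre   = c
  star c g (leaf i) = g i

  block : ℕ → List ℕ → List Colouring
  block c P = map (star c) (tuples (A c P))

  block-fits : ∀ c P → All (Fits c P) (block c P)
  block-fits c P = Allₚ.map⁺ (All.tabulate (λ g∈ → refl , ∈-tuples⁻ g∈))

  block-distinct : ∀ c P → AllPairs (λ f f' → ¬ SameImage f f') (block c P)
  block-distinct c P = leaves⇒images (block-fits c P) (AllPairsₚ.map⁺ (tuples-unique A!))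
    where
      A! : ∀ i → Unique (A c P i)
      A! i = available-unique (c ∈? X i) (proj₁ (L-size (leaf i)))
      leaves⇒images : ∀ {fs} → All (Fits c P) fs →
           AllPairs (λ f f' → ¬ (∀ i → f (leaf i) ≡ f' (leaf i))) fs →
           AllPairs (λ f f' → ¬ SameImage f f') fs
      leaves⇒images []             []           = []
      leaves⇒images (fits ∷ fitss) (f≉ ∷ f≉s) =
        All.zipWith (λ (fits' , f≉f') → f≉f' ∘ fits-sameImage⇒leaves≡ fits fits') (fitss , f≉)
        ∷ leaves⇒images fitss f≉s

  length-block-≥ : ∀ c P m → length P + suc m ≡ n → m * n ^ s-1 ≤ length (block c P)
  length-block-≥ c P m |P|+1+m≡n = begin
    m * n ^ s-1                      ≤⟨ *-monoˡ-≤ (n ^ s-1) m≤|Aj| ⟩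
    length (A c P j) * n ^ s-1       ≡⟨ product-constExcept (length ∘ A c P) j |Ai|≡n ⟨
    product (length ∘ A c P)         ≡⟨ length-tuples (A c P) ⟨
    length (tuples (A c P))          ≡⟨ length-map (star c) (tuples (A c P)) ⟨
    length (block c P)               ∎
    where
      open ≤-Reasoning
      j : Fin s
      j = proj₁ (owner c)
      |Ai|≡n : ∀ i → i ≢ j → length (A c P i) ≡ n
      |Ai|≡n i i≢j = trans (cong length (available-of-∉ (proj₂ (owner c) i i≢j) (c ∈? X i)))
                           (proj₂ (L-size (leaf i)))
      m≤|Aj| : m ≤ length (A c P j)
      m≤|Aj| = +-cancelˡ-≤ (length P) m _ (s≤s⁻¹ (begin
        suc (length P + m)               ≡⟨ trans (sym (+-suc (length P) m)) |P|+1+m≡n ⟩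
        n                                ≡⟨ proj₂ (L-size (leaf j)) ⟨
        length (X j)                     ≤⟨ length-available (c ∈? X j) (proj₁ (L-size (leaf j))) ⟩
        suc (length P + length (A c P j)) ∎))

  colourings : List ℕ → List ℕ → List Colouring
  colourings Q []       = []
  colourings Q (c ∷ cs) = block c Q ++ colourings (c ∷ Q) cs

  FitsSome : List ℕ → List ℕ → Colouring → Set
  FitsSome Q cs f = ∃₂ λ c P → Fits c P f × c ∈ cs × Q ⊆ P

  colourings-fit : ∀ Q cs → All (FitsSome Q cs) (colourings Q cs)
  colourings-fit Q []       = []
  colourings-fit Q (c ∷ cs) =
    Allₚ.++⁺ (All.map fromBlock (block-fits c Q)) (All.map weaken (colourings-fit (c ∷ Q) cs))
    where
      fromBlock : ∀ {f} → Fits c Q f → FitsSome Q (c ∷ cs) f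
      fromBlock fits = c , Q , fits , here refl , ⊆-refl
      weaken : ∀ {f} → FitsSome (c ∷ Q) cs f → FitsSome Q (c ∷ cs) f
      weaken (c' , P' , fits , c'∈cs , cQ⊆P') = c' , P' , fits , there c'∈cs , cQ⊆P' ∘ there

  colourings-distinct : ∀ Q {cs} → Unique cs → AllPairs (λ f f' → ¬ SameImage f f') (colourings Q cs)
  colourings-distinct Q {[]}     []           = []
  colourings-distinct Q {c ∷ cs} (c∉cs ∷ cs!) = AllPairsₚ.++⁺
    (block-distinct c Q)
    (colourings-distinct (c ∷ Q) cs!)
    (All.map (λ fits → All.map (separated fits) (colourings-fit (c ∷ Q) cs)) (block-fits c Q))
    where
      separated : ∀ {f f'} → Fits c Q f → FitsSome (c ∷ Q) cs f' → ¬ SameImage f f'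
      separated fits (c' , P' , fits' , c'∈cs , cQ⊆P') =
        fits-separated fits fits' (cQ⊆P' (here refl)) (≢-sym (All.lookup c∉cs c'∈cs))

  colourings-length : ∀ Q cs → length Q + length cs ≡ n →
    (length cs C 2) * n ^ s-1 ≤ length (colourings Q cs)
  colourings-length Q []       _  = z≤n
  colourings-length Q (c ∷ cs) |Q|+|c∷cs|≡n = begin
    (suc (length cs) C 2) * n ^ s-1
      ≡⟨ cong (_* n ^ s-1) ([1+m]C2≡m+mC2 (length cs)) ⟩
    (length cs + length cs C 2) * n ^ s-1
      ≡⟨ *-distribʳ-+ (n ^ s-1) (length cs) (length cs C 2) ⟩
    length cs * n ^ s-1 + (length cs C 2) * n ^ s-1
      ≤⟨ +-mono-≤ (length-block-≥ c Q (length cs) |Q|+|c∷cs|≡n)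
                  (colourings-length (c ∷ Q) cs (trans (sym (+-suc (length Q) (length cs))) |Q|+|c∷cs|≡n)) ⟩
    length (block c Q) + length (colourings (c ∷ Q) cs)
      ≡⟨ length-++ (block c Q) ⟨
    length (colourings Q (c ∷ cs)) ∎
    where open ≤-Reasoning

lemma22 : (s : ℕ) → 2 ≤ s → (L : ListAssignment s) →
    IsKAssignment (suc s) L → LeavesDisjoint L →
    ∃ λ (fs : List (StarV s → ℕ)) →
      All (IsProperLColoring L) fs ×
      AllPairs (λ f g → ¬ SameImage f g) fs ×
      ((suc s) C 2) * (suc s) ^ (s ∸ 1) ≤ length fs
lemma22 (suc s-1) _ L L-size disjoint =
  colourings [] Z ,
  All.map (λ (_ , _ , fits , c∈Z , _) → fits-proper c∈Z fits) (colourings-fit [] Z) ,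
  colourings-distinct [] Z! ,
  subst (λ m → (m C 2) * n ^ s-1 ≤ length (colourings [] Z)) |Z|≡n (colourings-length [] Z |Z|≡n)
  where
    open Construction L L-size disjoint
    Z : List ℕ
    Z = L centre
    Z! : Unique Z
    Z! = proj₁ (L-size centre)
    |Z|≡n : length Z ≡ n
    |Z|≡n = proj₂ (L-size centre)
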